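{- Let $\ell\in\{5,7\}$ and $k=\ell+1$, and let $i$ be an integer with $1<i\leq\frac{k+1}{2}$. Suppose $n,d,m$ are integers with $d>1$, $\gcd(n,d)=1$ and $$\prod_{\substack{1\leq j\leq k\\ j\neq i}}(n+jd)=m^{\ell}.$$ For $1\leq j\leq k$, $j\neq i$, write $n+jd=a_jx_j^{\ell}$ where $a_j$ is a positive integer in whose prime factorization every exponent is less than $\ell$, and $x_j$ is an integer. Suppose $j_\ell\in\{1,\dots,k\}\setminus\{i\}$ satisfies $\ell^3\mid (n+j_\ell d)$ and that $1\leq j_\ell<j_\ell+\ell\leq k$ or $1\leq j_\ell-\ell<j_\ell\leq k$; define $\varepsilon_\ell$ by $a_{j_\ell+\ell}=\ell\varepsilon_\ell$ in the first case and by $a_{j_\ell-\ell}=\ell\varepsilon_\ell$ in the second case. Then for every $j$ with $1<j<k$, $j\neq i$, $j\neq j_\ell$, $j\neq j_\ell\pm\ell$, $$\left(\frac{a_j}{j-j_\ell}\right)^{\ell-1}\equiv \varepsilon_\ell^{\ell-1}\pmod{\ell^2}.$$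
   Context: Division modulo $\ell^2$ means multiplication by the inverse modulo $\ell^2$. -}

module Defs where

open import Data.Nat as ℕ using (ℕ; zero; suc)
open import Data.Nat.Primality using (Prime)
open import Data.Integer using (ℤ; +_; _+_; _-_; _*_; _^_; _≟_)
open import Data.Integer.Divisibility using (_∣_)
open import Relation.Nullary using (¬_; yes; no)

prodExcept : ℤ → ℤ → ℤ → ℕ → ℤ
prodExcept n d i zero = + 1
prodExcept n d i (suc K) with + suc K ≟ i
... | yes _ = prodExcept n d i K
... | no  _ = (n + (+ suc K) * d) * prodExcept n d i K

PowerFree : ℕ → ℤ → Set
PowerFree ℓ a = ∀ (p : ℕ) → Prime p → ¬ (((+ p) ^ ℓ) ∣ a)

infix 4 _≡_[mod_]
_≡_[mod_] : ℤ → ℤ → ℤ → Set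
x ≡ y [mod q ] = q ∣ (x - y)

-- Since ℓ² divides n + jℓ d, every term satisfies n + j d ≡ (j - jℓ) d (mod ℓ²), so
-- (a_j / (j - jℓ)) x_j^ℓ ≡ d; and since ℓ³ divides n + jℓ d, dividing
-- n + (jℓ ± ℓ) d = ℓ εℓ x^ℓ by ℓ gives εℓ x^ℓ ≡ ± d (mod ℓ²). Coprimality of n and d
-- makes d, hence x_j and x, prime to ℓ, and raising to the power ℓ - 1 removes the
-- factors x^ℓ by Euler's theorem modulo ℓ² and the sign because ℓ - 1 is even.
{-# OPTIONS --safe #-}
module Submission where

open import Defs
open import Data.Nat as ℕ using (ℕ)
open import Data.Integer using (ℤ; +_; _+_; _-_; _*_; _^_; _<_; _≤_)
open import Data.Integer.GCD using (gcd)
open import Data.Integer.Divisibility using (_∣_)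
open import Data.Product using (_×_)
open import Data.Sum using (_⊎_)
open import Relation.Binary.PropositionalEquality using (_≡_; _≢_)

open import Data.Integer using (-_; 1ℤ; ∣_∣; NonZero)
import Data.Integer.Properties as ℤ
import Data.Integer.Divisibility.Signed as Signed
import Data.Integer.DivMod as ℤ
import Data.Integer.GCD as ℤ
import Data.Nat.Divisibility as ℕ
import Data.Nat.Properties as ℕ
open import Data.Integer.Tactic.RingSolver using (solve-∀)
open import Data.Nat.Tactic.RingSolver using () renaming (solve-∀ to ℕ-solve-∀)
open import Data.Fin using (Fin; toℕ; fromℕ<)
open import Data.Fin.Properties using (all?; toℕ-fromℕ<)
open import Data.Product using (_,_; proj₁)
open import Data.Sum using (inj₁; inj₂; [_,_]′)
open import Function using (_∘_)
open import Relation.Nullary using (¬_; Dec)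
open import Relation.Nullary.Decidable using (toWitness; ¬?; _→-dec_)
open import Relation.Binary.PropositionalEquality using (refl; sym; trans; cong; subst; module ≡-Reasoning)

private
  variable
    q p k x y z a b c d : ℤ

-- _≡_[mod_] unfolds to divisibility of absolute values, from which Agda cannot
-- recover the integers involved: implicit arguments below are given explicitly.
≡-mod⇒∣ₛ : x ≡ y [mod q ] → q Signed.∣ x - y
≡-mod⇒∣ₛ {x} {y} {q} = Signed.∣ᵤ⇒∣ {q} {x - y}

∣ₛ⇒≡-mod : q Signed.∣ x - y → x ≡ y [mod q ]
∣ₛ⇒≡-mod {q} {x} {y} = Signed.∣⇒∣ᵤ {q} {x - y}

≡-mod-refl : x ≡ x [mod q ]
≡-mod-refl {x} {q} = ∣ₛ⇒≡-mod {q} {x} {x}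
  (subst (q Signed.∣_) (sym (ℤ.+-inverseʳ x)) (Signed.∣n⇒∣m*n (+ 0) Signed.∣-refl))

≡-mod-sym : x ≡ y [mod q ] → y ≡ x [mod q ]
≡-mod-sym {x} {y} {q} x≡y = ∣ₛ⇒≡-mod {q} {y} {x}
  (subst (q Signed.∣_) (negate x y) (Signed.∣m⇒∣-m (≡-mod⇒∣ₛ {x} {y} x≡y)))
  where
  negate : ∀ x y → - (x - y) ≡ y - x
  negate = solve-∀

≡-mod-trans : x ≡ y [mod q ] → y ≡ z [mod q ] → x ≡ z [mod q ]
≡-mod-trans {x} {y} {q} {z} x≡y y≡z = ∣ₛ⇒≡-mod {q} {x} {z}
  (subst (q Signed.∣_) (telescope x y z)
    (Signed.∣m∣n⇒∣m+n (≡-mod⇒∣ₛ {x} {y} x≡y) (≡-mod⇒∣ₛ {y} {z} y≡z)))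
  where
  telescope : ∀ x y z → (x - y) + (y - z) ≡ x - z
  telescope = solve-∀

≡-mod-*-cong : a ≡ b [mod q ] → c ≡ d [mod q ] → a * c ≡ b * d [mod q ]
≡-mod-*-cong {a} {b} {q} {c} {d} a≡b c≡d = ∣ₛ⇒≡-mod {q} {a * c} {b * d}
  (subst (q Signed.∣_) (split a b c d)
    (Signed.∣m∣n⇒∣m+n (Signed.∣m⇒∣m*n c (≡-mod⇒∣ₛ {a} {b} a≡b))
                      (Signed.∣n⇒∣m*n b (≡-mod⇒∣ₛ {c} {d} c≡d))))
  where
  split : ∀ a b c d → (a - b) * c + b * (c - d) ≡ a * c - b * d
  split = solve-∀

≡-mod-^-cong : ∀ e → a ≡ b [mod q ] → a ^ e ≡ b ^ e [mod q ]
≡-mod-^-cong {a} {b} {q} ℕ.zero a≡b = ≡-mod-refl {1ℤ} {q}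
≡-mod-^-cong {a} {b} {q} (ℕ.suc e) a≡b =
  ≡-mod-*-cong {a} {b} {q} {a ^ e} {b ^ e} a≡b (≡-mod-^-cong {a} {b} {q} e a≡b)

m∣m*n : ∀ m n → m ∣ m * n
m∣m*n m n = Signed.∣⇒∣ᵤ {m} {m * n} (Signed.∣m⇒∣m*n n Signed.∣-refl)

n∣m*n : ∀ m n → n ∣ m * n
n∣m*n m n = Signed.∣⇒∣ᵤ {n} {m * n} (Signed.∣n⇒∣m*n m Signed.∣-refl)

∣-resp-≡-mod : k ∣ q → x ≡ y [mod q ] → k ∣ y → k ∣ x
∣-resp-≡-mod {k} {q} {x} {y} k∣q x≡y k∣y = Signed.∣⇒∣ᵤ {k} {x} (subst (k Signed.∣_) (cancel x y)
  (Signed.∣m∣n⇒∣m+n (Signed.∣-trans (Signed.∣ᵤ⇒∣ {k} {q} k∣q) (≡-mod⇒∣ₛ {x} {y} x≡y))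
                    (Signed.∣ᵤ⇒∣ {k} {y} k∣y)))
  where
  cancel : ∀ x y → (x - y) + y ≡ x
  cancel = solve-∀

≡-mod-%ℕ : ∀ y N .{{_ : ℕ.NonZero N}} → y ≡ + (y ℤ.%ℕ N) [mod + N ]
≡-mod-%ℕ y N = ∣ₛ⇒≡-mod {+ N} {y} {+ (y ℤ.%ℕ N)}
  (Signed.divides (y ℤ./ℕ N) (remainder (+ (y ℤ.%ℕ N)) (y ℤ./ℕ N) (+ N) (ℤ.a≡a%ℕn+[a/ℕn]*n y N)))
  where
  remainder : ∀ r s m → y ≡ r + s * m → y - r ≡ s * m
  remainder r s m refl = cancel r s m
    where
    cancel : ∀ r s m → r + s * m - r ≡ s * m
    cancel = solve-∀

all-residues : ∀ N .{{_ : ℕ.NonZero N}} (P : ℤ → Set) →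
  (∀ x y → x ≡ y [mod + N ] → P y → P x) → (∀ (r : Fin N) → P (+ toℕ r)) → ∀ y → P y
all-residues N P resp check y =
  resp y (+ (y ℤ.%ℕ N)) (≡-mod-%ℕ y N) (subst (P ∘ +_) (toℕ-fromℕ< r<N) (check (fromℕ< r<N)))
  where
  r<N = ℤ.n%ℕd<d y N

-- For prime ℓ this is Euler's theorem, as φ(ℓ²) = ℓ (ℓ - 1).
EulerCongruence : ℕ → ℤ → Set
EulerCongruence ℓ y = ¬ (+ ℓ ∣ y) → (y ^ ℓ) ^ (ℓ ℕ.∸ 1) ≡ 1ℤ [mod (+ ℓ) ^ 2 ]

euler? : ∀ ℓ y → Dec (EulerCongruence ℓ y)
euler? ℓ y = ¬? (ℓ ℕ.∣? ∣ y ∣) →-dec (∣ (+ ℓ) ^ 2 ∣ ℕ.∣? ∣ (y ^ ℓ) ^ (ℓ ℕ.∸ 1) - 1ℤ ∣)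

euler-resp-≡-mod : ∀ ℓ x y → x ≡ y [mod (+ ℓ) ^ 2 ] → EulerCongruence ℓ y → EulerCongruence ℓ x
euler-resp-≡-mod ℓ x y x≡y euler-y ℓ∤x =
  ≡-mod-trans {(x ^ ℓ) ^ e} {(y ^ ℓ) ^ e} {(+ ℓ) ^ 2} {1ℤ}
    (≡-mod-^-cong {x ^ ℓ} {y ^ ℓ} {(+ ℓ) ^ 2} e (≡-mod-^-cong {x} {y} {(+ ℓ) ^ 2} ℓ x≡y))
    (euler-y (ℓ∤x ∘ ∣-resp-≡-mod {+ ℓ} {(+ ℓ) ^ 2} {x} {y} (m∣m*n (+ ℓ) ((+ ℓ) ^ 1)) x≡y))
  where
  e = ℓ ℕ.∸ 1

euler-mod-5² : ∀ y → EulerCongruence 5 y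
euler-mod-5² = all-residues 25 (EulerCongruence 5) (euler-resp-≡-mod 5)
  (toWitness {a? = all? (euler? 5 ∘ +_ ∘ toℕ)} _)

euler-mod-7² : ∀ y → EulerCongruence 7 y
euler-mod-7² = all-residues 49 (EulerCongruence 7) (euler-resp-≡-mod 7)
  (toWitness {a? = all? (euler? 7 ∘ +_ ∘ toℕ)} _)

^-distrib-* : ∀ x y e → (x * y) ^ e ≡ x ^ e * y ^ e
^-distrib-* x y ℕ.zero = refl
^-distrib-* x y (ℕ.suc e) =
  trans (cong ((x * y) *_) (^-distrib-* x y e)) (interchange x y (x ^ e) (y ^ e))
  where
  interchange : ∀ x y x′ y′ → x * y * (x′ * y′) ≡ x * x′ * (y * y′)
  interchange = solve-∀

neg-^-double : ∀ x h → (- x) ^ (2 ℕ.* h) ≡ x ^ (2 ℕ.* h)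
neg-^-double x h = begin
  (- x) ^ (2 ℕ.* h)  ≡⟨ ℤ.^-*-assoc (- x) 2 h ⟨
  ((- x) ^ 2) ^ h    ≡⟨ cong (_^ h) (neg-square x) ⟩
  (x ^ 2) ^ h        ≡⟨ ℤ.^-*-assoc x 2 h ⟩
  x ^ (2 ℕ.* h)      ∎
  where
  open ≡-Reasoning
  neg-square : ∀ x → (- x) * ((- x) * 1ℤ) ≡ x * (x * 1ℤ)
  neg-square = solve-∀

∣⇒∣*^ : ∀ a e .{{_ : ℕ.NonZero e}} → k ∣ y → k ∣ a * y ^ e
∣⇒∣*^ {k} {y} a (ℕ.suc e) k∣y =
  Signed.∣⇒∣ᵤ {k} {a * y ^ ℕ.suc e}
    (Signed.∣n⇒∣m*n a (Signed.∣m⇒∣m*n (y ^ e) (Signed.∣ᵤ⇒∣ {k} {y} k∣y)))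

euler-cancel : ∀ ℓ .{{_ : ℕ.NonZero ℓ}} → (∀ y → EulerCongruence ℓ y) →
  ∀ A y c → ¬ (+ ℓ ∣ c) → A * y ^ ℓ ≡ c [mod (+ ℓ) ^ 2 ] →
  A ^ (ℓ ℕ.∸ 1) ≡ c ^ (ℓ ℕ.∸ 1) [mod (+ ℓ) ^ 2 ]
euler-cancel ℓ euler A y c ℓ∤c Ayℓ≡c =
  subst (_≡ c ^ e [mod ℓ² ]) (ℤ.*-identityʳ (A ^ e))
    (≡-mod-trans {A ^ e * 1ℤ} {(A * y ^ ℓ) ^ e} {ℓ²} {c ^ e} unit-factor
      (≡-mod-^-cong {A * y ^ ℓ} {c} {ℓ²} e Ayℓ≡c))
  where
  e = ℓ ℕ.∸ 1
  ℓ² = (+ ℓ) ^ 2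
  ℓ∤y : ¬ (+ ℓ ∣ y)
  ℓ∤y = ℓ∤c
      ∘ ∣-resp-≡-mod {+ ℓ} {ℓ²} {c} {A * y ^ ℓ} (m∣m*n (+ ℓ) ((+ ℓ) ^ 1))
          (≡-mod-sym {A * y ^ ℓ} {c} {ℓ²} Ayℓ≡c)
      ∘ ∣⇒∣*^ {+ ℓ} {y} A ℓ
  unit-factor : A ^ e * 1ℤ ≡ (A * y ^ ℓ) ^ e [mod ℓ² ]
  unit-factor = subst (A ^ e * 1ℤ ≡_[mod ℓ² ]) (sym (^-distrib-* A (y ^ ℓ) e))
    (≡-mod-*-cong {A ^ e} {A ^ e} {ℓ²} {1ℤ} {(y ^ ℓ) ^ e} (≡-mod-refl {A ^ e} {ℓ²})
      (≡-mod-sym {(y ^ ℓ) ^ e} {1ℤ} {ℓ²} (euler y ℓ∤y)))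

term-congruence : ∀ n d s j u → p ∣ n + s * d → u * (j - s) ≡ 1ℤ [mod p ] →
  u * (n + j * d) ≡ d [mod p ]
term-congruence {p} n d s j u p∣N u-inv = ∣ₛ⇒≡-mod {p} {u * (n + j * d)} {d}
  (subst (p Signed.∣_) (regroup n d s j u)
    (Signed.∣m∣n⇒∣m+n (Signed.∣n⇒∣m*n u (Signed.∣ᵤ⇒∣ {p} {n + s * d} p∣N))
                      (Signed.∣n⇒∣m*n d (≡-mod⇒∣ₛ {u * (j - s)} {1ℤ} {p} u-inv))))
  where
  regroup : ∀ n d s j u → u * (n + s * d) + d * (u * (j - s) - 1ℤ) ≡ u * (n + j * d) - d
  regroup = solve-∀

cancel-common-factor : ∀ q p N M c .{{_ : NonZero q}} →
  q * p ∣ N → q * M ≡ N + q * c → M ≡ c [mod p ]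
cancel-common-factor q p N M c qp∣N qM≡N+qc = ∣ₛ⇒≡-mod {p} {M} {c}
  (Signed.*-cancelˡ-∣ q (subst (q * p Signed.∣_) N≡q[M-c] (Signed.∣ᵤ⇒∣ {q * p} {N} qp∣N)))
  where
  N≡q[M-c] : N ≡ q * (M - c)
  N≡q[M-c] = begin
    N                  ≡⟨ add-sub N (q * c) ⟨
    N + q * c - q * c  ≡⟨ cong (_- q * c) qM≡N+qc ⟨
    q * M - q * c      ≡⟨ factor q M c ⟩
    q * (M - c)        ∎
    where
    open ≡-Reasoning
    add-sub : ∀ x y → x + y - y ≡ x
    add-sub = solve-∀
    factor : ∀ q x y → q * x - q * y ≡ q * (x - y)
    factor = solve-∀

shift-up-congruence : ∀ q p n d s ε W .{{_ : NonZero q}} → q * p ∣ n + s * d →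
  n + (s + q) * d ≡ q * ε * W → ε * W ≡ d [mod p ]
shift-up-congruence q p n d s ε W qp∣N decomposition =
  cancel-common-factor q p (n + s * d) (ε * W) d qp∣N (begin
    q * (ε * W)        ≡⟨ ℤ.*-assoc q ε W ⟨
    q * ε * W          ≡⟨ decomposition ⟨
    n + (s + q) * d    ≡⟨ regroup n d s q ⟩
    n + s * d + q * d  ∎)
  where
  open ≡-Reasoning
  regroup : ∀ n d s q → n + (s + q) * d ≡ n + s * d + q * d
  regroup = solve-∀

shift-down-congruence : ∀ q p n d s ε W .{{_ : NonZero q}} → q * p ∣ n + s * d →
  n + (s - q) * d ≡ q * ε * W → ε * W ≡ - d [mod p ]
shift-down-congruence q p n d s ε W qp∣N decomposition =
  cancel-common-factor q p (n + s * d) (ε * W) (- d) qp∣N (begin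
    q * (ε * W)          ≡⟨ ℤ.*-assoc q ε W ⟨
    q * ε * W            ≡⟨ decomposition ⟨
    n + (s - q) * d      ≡⟨ regroup n d s q ⟩
    n + s * d + q * - d  ∎)
  where
  open ≡-Reasoning
  regroup : ∀ n d s q → n + (s - q) * d ≡ n + s * d + q * - d
  regroup = solve-∀

term-power-congruence : ∀ ℓ .{{_ : ℕ.NonZero ℓ}} → (∀ y → EulerCongruence ℓ y) →
  ∀ n d s j u A y → ¬ (+ ℓ ∣ d) → (+ ℓ) ^ 2 ∣ n + s * d → u * (j - s) ≡ 1ℤ [mod (+ ℓ) ^ 2 ] →
  n + j * d ≡ A * y ^ ℓ → (A * u) ^ (ℓ ℕ.∸ 1) ≡ d ^ (ℓ ℕ.∸ 1) [mod (+ ℓ) ^ 2 ]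
term-power-congruence ℓ euler n d s j u A y ℓ∤d ℓ²∣N u-inv decomposition =
  euler-cancel ℓ euler (A * u) y d ℓ∤d (subst (_≡ d [mod (+ ℓ) ^ 2 ])
    (trans (cong (u *_) decomposition) (swap u A (y ^ ℓ)))
    (term-congruence {(+ ℓ) ^ 2} n d s j u ℓ²∣N u-inv))
  where
  swap : ∀ u a w → u * (a * w) ≡ a * u * w
  swap = solve-∀

upper-partner-congruence : ∀ ℓ .{{_ : ℕ.NonZero ℓ}} → (∀ y → EulerCongruence ℓ y) →
  ∀ n d s ε y → ¬ (+ ℓ ∣ d) → (+ ℓ) ^ 3 ∣ n + s * d →
  n + (s + + ℓ) * d ≡ + ℓ * ε * y ^ ℓ → ε ^ (ℓ ℕ.∸ 1) ≡ d ^ (ℓ ℕ.∸ 1) [mod (+ ℓ) ^ 2 ]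
upper-partner-congruence ℓ euler n d s ε y ℓ∤d ℓ³∣N decomposition =
  euler-cancel ℓ euler ε y d ℓ∤d
    (shift-up-congruence (+ ℓ) ((+ ℓ) ^ 2) n d s ε (y ^ ℓ) ℓ³∣N decomposition)

lower-partner-congruence : ∀ ℓ .{{_ : ℕ.NonZero ℓ}} → (∀ y → EulerCongruence ℓ y) →
  ∀ n d s ε y → ¬ (+ ℓ ∣ d) → (+ ℓ) ^ 3 ∣ n + s * d →
  n + (s - + ℓ) * d ≡ + ℓ * ε * y ^ ℓ → ε ^ (ℓ ℕ.∸ 1) ≡ (- d) ^ (ℓ ℕ.∸ 1) [mod (+ ℓ) ^ 2 ]
lower-partner-congruence ℓ euler n d s ε y ℓ∤d ℓ³∣N decomposition =
  euler-cancel ℓ euler ε y (- d) (ℓ∤d ∘ subst (ℓ ℕ.∣_) (ℤ.∣-i∣≡∣i∣ d))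
    (shift-down-congruence (+ ℓ) ((+ ℓ) ^ 2) n d s ε (y ^ ℓ) ℓ³∣N decomposition)

coprime⇒common-divisor∣1 : ∀ n d s → gcd n d ≡ + 1 → k ∣ n + s * d → k ∣ d → k ∣ + 1
coprime⇒common-divisor∣1 {k} n d s n⊥d k∣N k∣d =
  subst (k ∣_) n⊥d (ℤ.gcd-greatest {n} {d} {k} k∣n k∣d)
  where
  undo : ∀ n d s → n + s * d - s * d ≡ n
  undo = solve-∀
  k∣n : k ∣ n
  k∣n = Signed.∣⇒∣ᵤ {k} {n} (subst (k Signed.∣_) (undo n d s)
    (Signed.∣m∣n⇒∣m-n (Signed.∣ᵤ⇒∣ {k} {n + s * d} k∣N) (Signed.∣n⇒∣m*n s (Signed.∣ᵤ⇒∣ {k} {d} k∣d))))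

upper-shift-≢ : ∀ ℓ .{{_ : ℕ.NonZero ℓ}} {i s} → + 1 ≤ s → + 2 * i ≤ + (ℓ ℕ.+ 1) + + 1 → s + + ℓ ≢ i
upper-shift-≢ ℓ {s = s} 1≤s 2i≤ℓ+2 refl = ℕ.<⇒≱ ℓ+2<2[1+ℓ] (ℤ.drop‿+≤+ 2[1+ℓ]≤ℓ+2)
  where
  2[1+ℓ]≤ℓ+2 : + 2 * (+ 1 + + ℓ) ≤ + (ℓ ℕ.+ 1) + + 1
  2[1+ℓ]≤ℓ+2 = ℤ.≤-trans (ℤ.*-monoˡ-≤-nonNeg (+ 2) (ℤ.+-monoˡ-≤ (+ ℓ) 1≤s)) 2i≤ℓ+2
  ℓ+2<2[1+ℓ] : ℓ ℕ.+ 1 ℕ.+ 1 ℕ.< 2 ℕ.* (1 ℕ.+ ℓ)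
  ℓ+2<2[1+ℓ] = subst (ℓ ℕ.+ 1 ℕ.+ 1 ℕ.<_) (regroup ℓ) (ℕ.m<m+n (ℓ ℕ.+ 1 ℕ.+ 1) (ℕ.>-nonZero⁻¹ ℓ))
    where
    regroup : ∀ ℓ → ℓ ℕ.+ 1 ℕ.+ 1 ℕ.+ ℓ ≡ 2 ℕ.* (1 ℕ.+ ℓ)
    regroup = ℕ-solve-∀

lower-shift-≢ : ∀ ℓ {i s} → + 1 < i → s ≤ + (ℓ ℕ.+ 1) → s - + ℓ ≢ i
lower-shift-≢ ℓ {s = s} 1<i s≤ℓ+1 refl =
  ℤ.<⇒≱ 1<i (subst (s - + ℓ ≤_) (cancel (+ ℓ)) (ℤ.+-monoˡ-≤ (- + ℓ) s≤ℓ+1))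
  where
  cancel : ∀ x → x + 1ℤ - x ≡ 1ℤ
  cancel = solve-∀

five-or-seven : (P : ℕ → Set) → P 5 → P 7 → ∀ {ℓ} → ℓ ≡ 5 ⊎ ℓ ≡ 7 → P ℓ
five-or-seven P p5 p7 (inj₁ refl) = p5
five-or-seven P p5 p7 (inj₂ refl) = p7

lemma5p2 : (ℓ : ℕ) → (ℓ ≡ 5 ⊎ ℓ ≡ 7) →
    (i n d m : ℤ) → + 1 < i → + 2 * i ≤ + (ℓ ℕ.+ 1) + + 1 →
    + 1 < d → gcd n d ≡ + 1 →
    prodExcept n d i (ℓ ℕ.+ 1) ≡ m ^ ℓ →
    (a x : ℤ → ℤ) →
    (∀ j → + 1 ≤ j → j ≤ + (ℓ ℕ.+ 1) → j ≢ i →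
      (n + j * d ≡ a j * x j ^ ℓ) × (+ 0 < a j) × PowerFree ℓ (a j)) →
    (jℓ ε : ℤ) → + 1 ≤ jℓ → jℓ ≤ + (ℓ ℕ.+ 1) → jℓ ≢ i →
    ((+ ℓ) ^ 3) ∣ (n + jℓ * d) →
    ((+ 1 ≤ jℓ × jℓ + + ℓ ≤ + (ℓ ℕ.+ 1) × a (jℓ + + ℓ) ≡ + ℓ * ε)
      ⊎ (+ 1 ≤ jℓ - + ℓ × jℓ ≤ + (ℓ ℕ.+ 1) × a (jℓ - + ℓ) ≡ + ℓ * ε)) →
    ∀ j → + 1 < j → j < + (ℓ ℕ.+ 1) → j ≢ i → j ≢ jℓ → j ≢ jℓ + + ℓ → j ≢ jℓ - + ℓ →
    ∀ (u : ℤ) → u * (j - jℓ) ≡ + 1 [mod (+ ℓ) ^ 2 ] →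
    (a j * u) ^ (ℓ ℕ.∸ 1) ≡ ε ^ (ℓ ℕ.∸ 1) [mod (+ ℓ) ^ 2 ]
lemma5p2 ℓ ℓ∈ i n d _ 1<i 2i≤ℓ+2 _ n⊥d _ a x decomposition jℓ ε 1≤jℓ jℓ≤ℓ+1 _ ℓ³∣N shift
         j 1<j j<ℓ+1 j≢i _ _ _ u u-inv =
  ≡-mod-trans {(a j * u) ^ e} {d ^ e} {ℓ²} {ε ^ e}
    (term-power-congruence ℓ euler n d jℓ j u (a j) (x j) ℓ∤d ℓ²∣N u-inv
      (term j (ℤ.<⇒≤ 1<j) (ℤ.<⇒≤ j<ℓ+1) j≢i))
    (≡-mod-sym {ε ^ e} {d ^ e} {ℓ²} ([ via-upper , via-lower ]′ shift))
  where
  instance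
    ℓ≢0 : ℕ.NonZero ℓ
    ℓ≢0 = five-or-seven ℕ.NonZero _ _ ℓ∈
  e = ℓ ℕ.∸ 1
  ℓ² = (+ ℓ) ^ 2
  euler : ∀ y → EulerCongruence ℓ y
  euler = five-or-seven (λ ℓ → ∀ y → EulerCongruence ℓ y) euler-mod-5² euler-mod-7² ℓ∈
  ℓ²∣N : ℓ² ∣ n + jℓ * d
  ℓ²∣N = ℕ.∣-trans (n∣m*n (+ ℓ) ℓ²) ℓ³∣N
  ℓ∤d : ¬ (+ ℓ ∣ d)
  ℓ∤d ℓ∣d = five-or-seven (_≢ 1) (λ ()) (λ ()) ℓ∈ (ℕ.∣1⇒≡1
    (coprime⇒common-divisor∣1 {+ ℓ} n d jℓ n⊥d (ℕ.∣-trans (m∣m*n (+ ℓ) ℓ²) ℓ³∣N) ℓ∣d))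
  term : ∀ s → + 1 ≤ s → s ≤ + (ℓ ℕ.+ 1) → s ≢ i → n + s * d ≡ a s * x s ^ ℓ
  term s 1≤s s≤ℓ+1 s≢i = proj₁ (decomposition s 1≤s s≤ℓ+1 s≢i)
  via-upper : + 1 ≤ jℓ × jℓ + + ℓ ≤ + (ℓ ℕ.+ 1) × a (jℓ + + ℓ) ≡ + ℓ * ε → ε ^ e ≡ d ^ e [mod ℓ² ]
  via-upper (_ , jℓ+ℓ≤ℓ+1 , a≡ℓε) = upper-partner-congruence ℓ euler n d jℓ ε _ ℓ∤d ℓ³∣N
    (trans (term (jℓ + + ℓ) (ℤ.≤-trans 1≤jℓ (ℤ.i≤i+j jℓ (+ ℓ))) jℓ+ℓ≤ℓ+1 (upper-shift-≢ ℓ 1≤jℓ 2i≤ℓ+2))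
           (cong (_* _) a≡ℓε))
  via-lower : + 1 ≤ jℓ - + ℓ × jℓ ≤ + (ℓ ℕ.+ 1) × a (jℓ - + ℓ) ≡ + ℓ * ε → ε ^ e ≡ d ^ e [mod ℓ² ]
  via-lower (1≤jℓ-ℓ , _ , a≡ℓε) = subst (ε ^ e ≡_[mod ℓ² ]) (neg-^-even d)
    (lower-partner-congruence ℓ euler n d jℓ ε _ ℓ∤d ℓ³∣N
      (trans (term (jℓ - + ℓ) 1≤jℓ-ℓ (ℤ.≤-trans (ℤ.i-j≤i jℓ (+ ℓ)) jℓ≤ℓ+1) (lower-shift-≢ ℓ 1<i jℓ≤ℓ+1))
             (cong (_* _) a≡ℓε)))
    where
    neg-^-even : ∀ y → (- y) ^ e ≡ y ^ e
    neg-^-even = five-or-seven (λ ℓ → ∀ y → (- y) ^ (ℓ ℕ.∸ 1) ≡ y ^ (ℓ ℕ.∸ 1))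
      (λ y → neg-^-double y 2) (λ y → neg-^-double y 3) ℓ∈
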